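{- Let $a\in\mathbb{N}$ and put $\mathfrak b(a,f)=1+3(2a+1)f$. For every $Z>0$ there exists an integer $f\ge Z$ such that $\mathfrak b(a,f)$ is a perfect square and a power of $2$.
   Context: $\mathbb{N}=\{0,1,2,\dots\}$. -}

module Defs where

open import Data.Nat using (ℕ; _+_; _*_; _^_)
open import Data.Product using (∃)
open import Relation.Binary.PropositionalEquality using (_≡_)

𝔟 : ℕ → ℕ → ℕ
𝔟 a f = 1 + 3 * (2 * a + 1) * f

IsSquare : ℕ → Set
IsSquare n = ∃ λ m → n ≡ m * m

IsPowerOf2 : ℕ → Set
IsPowerOf2 n = ∃ λ k → n ≡ 2 ^ k

-- If n is coprime to m then n ^ e ≡ 1 (mod m) for some e > 0: by pigeonhole two of
-- n ^ 0, …, n ^ m agree modulo m, and the common factor n ^ i cancels from their difference.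
-- For the odd m = 3(2a + 1) this gives 2 ^ e = 1 + m q with q ≥ 1, and then
-- (2 ^ e) ^ (2Z) = (1 + m q) ^ (2Z) = 1 + m r with r ≥ 2Z q ≥ Z by Bernoulli's inequality;
-- f = r works, since (2 ^ e) ^ (2Z) is both a square and a power of 2.
module Submission where

open import Defs
open import Data.Nat using (ℕ; _≤_; _<_)
open import Data.Product using (∃; _×_)

open import Data.Nat using (zero; suc; _+_; _*_; _^_; _∸_; _%_; _/_; z≤n; s≤s; z<s; NonZero; ≢-nonZero; >-nonZero)
open import Data.Nat.Properties
open import Data.Nat.DivMod using (m≡m%n+[m/n]*n; _mod_)
open import Data.Nat.Divisibility using (_∣_; divides)
open import Data.Nat.Coprimality using (Coprime; coprime-+; coprime-divisor; 1-coprimeTo)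
open import Data.Nat.Tactic.RingSolver using (solve-∀)
open import Data.Fin using (toℕ)
open import Data.Fin.Properties using (pigeonhole; toℕ-fromℕ<)
open import Data.Product using (_,_)
open import Relation.Nullary using (contradiction)
open import Relation.Binary.PropositionalEquality

coprime-*-+ : ∀ {m n} k → Coprime m n → Coprime (k * n + m) n
coprime-*-+ zero c = c
coprime-*-+ {m} {n} (suc k) c =
  subst (λ x → Coprime x n) (sym (+-assoc n (k * n) m)) (coprime-+ (coprime-*-+ k c))

odd-coprime-2 : ∀ k → Coprime (k * 2 + 1) 2
odd-coprime-2 k = coprime-*-+ k (1-coprimeTo 2)

coprime-divisor-^ : ∀ {m n o} → Coprime m n → ∀ i → m ∣ n ^ i * o → m ∣ o
coprime-divisor-^ {m} {o = o} c zero m∣ = subst (m ∣_) (+-identityʳ o) m∣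
coprime-divisor-^ {m} {n} {o} c (suc i) m∣ =
  coprime-divisor-^ c i (coprime-divisor c (subst (m ∣_) (*-assoc n (n ^ i) o) m∣))

%≡%⇒∣∸ : ∀ m n d .{{_ : NonZero d}} → m % d ≡ n % d → d ∣ m ∸ n
%≡%⇒∣∸ m n d m%d≡n%d = divides (m / d ∸ n / d) (begin
  m ∸ n                                     ≡⟨ cong₂ _∸_ (m≡m%n+[m/n]*n m d) (m≡m%n+[m/n]*n n d) ⟩
  (m % d + m / d * d) ∸ (n % d + n / d * d) ≡⟨ cong (λ r → r + m / d * d ∸ (n % d + n / d * d)) m%d≡n%d ⟩
  (n % d + m / d * d) ∸ (n % d + n / d * d) ≡⟨ [m+n]∸[m+o]≡n∸o (n % d) (m / d * d) (n / d * d) ⟩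
  m / d * d ∸ n / d * d                     ≡⟨ *-distribʳ-∸ d (m / d) (n / d) ⟨
  (m / d ∸ n / d) * d                       ∎)
  where open ≡-Reasoning

^-≡-mod⇒∣^∸1 : ∀ {m n} .{{_ : NonZero m}} → Coprime m n → ∀ i e →
               n ^ (i + e) % m ≡ n ^ i % m → m ∣ n ^ e ∸ 1
^-≡-mod⇒∣^∸1 {m} {n} c i e ≡-mod = coprime-divisor-^ c i (subst (m ∣_) factor (%≡%⇒∣∸ _ _ m ≡-mod))
  where
  open ≡-Reasoning
  factor : n ^ (i + e) ∸ n ^ i ≡ n ^ i * (n ^ e ∸ 1)
  factor = begin
    n ^ (i + e) ∸ n ^ i       ≡⟨ cong₂ _∸_ (sym (^-distribˡ-+-* n i e)) (*-identityʳ (n ^ i)) ⟨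
    n ^ i * n ^ e ∸ n ^ i * 1 ≡⟨ *-distribˡ-∸ (n ^ i) (n ^ e) 1 ⟨
    n ^ i * (n ^ e ∸ 1)       ∎

coprime⇒∃[e]m∣n^e∸1 : ∀ {m n} .{{_ : NonZero m}} → Coprime m n → ∃ λ e → 0 < e × m ∣ n ^ e ∸ 1
coprime⇒∃[e]m∣n^e∸1 {m} {n} c with pigeonhole (n<1+n m) (λ i → n ^ toℕ i mod m)
... | i , j , i<j , mod≡ = toℕ j ∸ toℕ i , m<n⇒0<n∸m i<j , ^-≡-mod⇒∣^∸1 c (toℕ i) _ ≡-mod
  where
  ≡-mod : n ^ (toℕ i + (toℕ j ∸ toℕ i)) % m ≡ n ^ toℕ i % m
  ≡-mod = begin
    n ^ (toℕ i + (toℕ j ∸ toℕ i)) % m ≡⟨ cong (λ x → n ^ x % m) (m+[n∸m]≡n (<⇒≤ i<j)) ⟩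
    n ^ toℕ j % m                     ≡⟨ toℕ-fromℕ< _ ⟨
    toℕ (n ^ toℕ j mod m)             ≡⟨ cong toℕ mod≡ ⟨
    toℕ (n ^ toℕ i mod m)             ≡⟨ toℕ-fromℕ< _ ⟩
    n ^ toℕ i % m                     ∎
    where open ≡-Reasoning

∣∸1⇒≡1+m*q : ∀ {m P} → 1 < P → m ∣ P ∸ 1 → ∃ λ q → 0 < q × P ≡ 1 + m * q
∣∸1⇒≡1+m*q 1<P (divides zero P∸1≡0) = contradiction P∸1≡0 (n>0⇒n≢0 (m<n⇒0<n∸m 1<P))
∣∸1⇒≡1+m*q {m} {P} 1<P (divides q@(suc _) P∸1≡q*m) = q , z<s , (begin
  P           ≡⟨ m+[n∸m]≡n (<⇒≤ 1<P) ⟨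
  1 + (P ∸ 1) ≡⟨ cong (1 +_) (trans P∸1≡q*m (*-comm q m)) ⟩
  1 + m * q   ∎)
  where open ≡-Reasoning

[1+m*q]^N≡1+m*r : ∀ m q N → ∃ λ r → N * q ≤ r × (1 + m * q) ^ N ≡ 1 + m * r
[1+m*q]^N≡1+m*r m q zero = 0 , z≤n , cong suc (sym (*-zeroʳ m))
[1+m*q]^N≡1+m*r m q (suc N) with [1+m*q]^N≡1+m*r m q N
... | r , Nq≤r , eq = q + r + m * q * r
                    , ≤-trans (+-monoʳ-≤ q Nq≤r) (m≤m+n (q + r) (m * q * r))
                    , trans (cong ((1 + m * q) *_) eq) (expand m q r)
  where
  expand : ∀ m q r → (1 + m * q) * (1 + m * r) ≡ 1 + m * (q + r + m * q * r)
  expand = solve-∀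

coprime-2⇒1+m*f-square-and-power-of-2 :
  ∀ {m} .{{_ : NonZero m}} → Coprime m 2 → ∀ Z →
  ∃ λ f → Z ≤ f × IsSquare (1 + m * f) × IsPowerOf2 (1 + m * f)
coprime-2⇒1+m*f-square-and-power-of-2 {m} c Z
  with e , 0<e , m∣2^e∸1 ← coprime⇒∃[e]m∣n^e∸1 c
  with q , 0<q , 2^e≡1+mq ← ∣∸1⇒≡1+m*q (^-monoʳ-< 2 (s≤s (s≤s z≤n)) 0<e) m∣2^e∸1
  with r , 2Zq≤r , [1+mq]^2Z≡1+mr ← [1+m*q]^N≡1+m*r m q (Z + Z)
  = r , Z≤r , ((2 ^ e) ^ Z , trans 1+mr≡ (^-distribˡ-+-* (2 ^ e) Z Z))
            , (e * (Z + Z) , trans 1+mr≡ (^-*-assoc 2 e (Z + Z)))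
  where
  Z≤r : Z ≤ r
  Z≤r = ≤-trans (m≤m+n Z Z) (≤-trans (m≤m*n (Z + Z) q {{>-nonZero 0<q}}) 2Zq≤r)
  1+mr≡ : 1 + m * r ≡ (2 ^ e) ^ (Z + Z)
  1+mr≡ = trans (sym [1+mq]^2Z≡1+mr) (cong (_^ (Z + Z)) (sym 2^e≡1+mq))

lemma2p2 : (a Z : ℕ) → 0 < Z → ∃ λ f → Z ≤ f × IsSquare (𝔟 a f) × IsPowerOf2 (𝔟 a f)
lemma2p2 a Z _ = coprime-2⇒1+m*f-square-and-power-of-2 {{m≢0}} m-coprime-2 Z
  where
  m-odd : ∀ a → 3 * (2 * a + 1) ≡ (3 * a + 1) * 2 + 1
  m-odd = solve-∀
  m-coprime-2 : Coprime (3 * (2 * a + 1)) 2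
  m-coprime-2 = subst (λ m → Coprime m 2) (sym (m-odd a)) (odd-coprime-2 (3 * a + 1))
  m≢0 : NonZero (3 * (2 * a + 1))
  m≢0 = m*n≢0 3 (2 * a + 1) {{_}} {{≢-nonZero (m+1+n≢0 (2 * a))}}
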